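{- Let $A_1$ and $A_2$ be simple and covering atoms that are unifiable with most general unifier $\sigma$, let $G$ be a flat literal and $\mathcal G$ a set of flat literals with $\mathrm{Var}(A_1)=\mathrm{Var}(G)=\mathrm{Var}(\mathcal G)$. If $A_1$ contains a compound term, then $G\sigma$ and all literals of $\mathcal G\sigma$ are flat and $\mathrm{Var}(A_1\sigma)=\mathrm{Var}(G\sigma)=\mathrm{Var}(\mathcal G\sigma)$.
   Context: A compound term is a term that is neither a variable nor a constant. $\mathrm{Var}(E)$ is the set of variables of $E$ (for a set of literals, the union). A literal is flat if every argument is a variable or constant; simple if every argument is a variable, a constant, or a compound term $f(u_1,\dots,u_n)$ with each $u_i$ a variable or constant. An atom $L$ is covering if every compound term $t$ in $L$ satisfies $\mathrm{Var}(t)=\mathrm{Var}(L)$. -}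

module Defs where

open import Data.Nat using (ℕ; _<_)
open import Data.Bool using (Bool)
open import Data.Empty using (⊥)
open import Data.Unit using (⊤)
open import Data.Sum using (_⊎_)
open import Data.Product using (_×_; ∃; Σ; _,_)
open import Data.Vec using (Vec; []; _∷_)
open import Data.List using (List)
import Data.List as List
import Data.Vec.Relation.Unary.Any as VAny
import Data.Vec.Relation.Unary.All as VAll
import Data.List.Relation.Unary.Any as LAny
open import Data.List.Membership.Propositional using (_∈_)
open import Relation.Binary.PropositionalEquality using (_≡_)

-- A first-order signature: function symbols (constants are the
-- function symbols of arity 0) and predicate symbols, with arities.
-- Variables are natural numbers (a countably infinite supply).
record Signature : Set₁ where
  field
    Fun   : Set
    arity : Fun → ℕ
    Pred  : Set
    parity : Pred → ℕ

SameVars : (ℕ → Set) → (ℕ → Set) → Set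
SameVars P Q = ∀ x → (P x → Q x) × (Q x → P x)

module _ {S : Signature} where
  open Signature S

  data Term : Set where
    var : ℕ → Term
    fun : (f : Fun) → Vec Term (arity f) → Term

  IsVar : Term → Set
  IsVar (var _)   = ⊤
  IsVar (fun _ _) = ⊥

  IsConst : Term → Set
  IsConst (var _)   = ⊥
  IsConst (fun f _) = arity f ≡ 0

  VarOrConst : Term → Set
  VarOrConst t = IsVar t ⊎ IsConst t

  Compound : Term → Set
  Compound (var _)   = ⊥
  Compound (fun f _) = 0 < arity f

  data _∈ᵥ_ (x : ℕ) : Term → Set where
    here : x ∈ᵥ var x
    there : ∀ {f ts} → VAny.Any (x ∈ᵥ_) ts → x ∈ᵥ fun f ts

  data _⊑_ (t : Term) : Term → Set where
    self : t ⊑ t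
    sub  : ∀ {f ts} → VAny.Any (t ⊑_) ts → t ⊑ fun f ts

  record Atom : Set where
    constructor atom
    field
      pred : Pred
      args : Vec Term (parity pred)
  open Atom public

  record Literal : Set where
    constructor lit
    field
      positive : Bool
      atomOf   : Atom
  open Literal public

  Subst : Set
  Subst = ℕ → Term

  mutual
    _·_ : Term → Subst → Term
    var x    · σ = σ x
    fun f ts · σ = fun f (ts ·ᵛ σ)

    _·ᵛ_ : ∀ {n} → Vec Term n → Subst → Vec Term n
    []       ·ᵛ σ = []
    (t ∷ ts) ·ᵛ σ = (t · σ) ∷ (ts ·ᵛ σ)

  _·ᴬ_ : Atom → Subst → Atom
  atom p ts ·ᴬ σ = atom p (ts ·ᵛ σ)

  _·ᴸ_ : Literal → Subst → Literal
  lit b A ·ᴸ σ = lit b (A ·ᴬ σ)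

  _·ˢ_ : List Literal → Subst → List Literal
  Ls ·ˢ σ = List.map (_·ᴸ σ) Ls

  VarT : Term → ℕ → Set
  VarT t x = x ∈ᵥ t

  VarA : Atom → ℕ → Set
  VarA A x = VAny.Any (x ∈ᵥ_) (args A)

  VarL : Literal → ℕ → Set
  VarL L = VarA (atomOf L)

  VarLs : List Literal → ℕ → Set
  VarLs Ls x = ∃ λ L → L ∈ Ls × VarL L x

  _⊑ᴬ_ : Term → Atom → Set
  t ⊑ᴬ A = VAny.Any (t ⊑_) (args A)

  ContainsCompound : Atom → Set
  ContainsCompound A = ∃ λ t → t ⊑ᴬ A × Compound t

  FlatA : Atom → Set
  FlatA A = VAll.All VarOrConst (args A)

  FlatL : Literal → Set
  FlatL L = FlatA (atomOf L)

  -- simple argument: a variable, a constant, or f(u1..un) with each ui a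
  -- variable or constant (constants are covered by the second clause, n = 0)
  SimpleArg : Term → Set
  SimpleArg (var _)    = ⊤
  SimpleArg (fun f ts) = VAll.All VarOrConst ts

  SimpleA : Atom → Set
  SimpleA A = VAll.All SimpleArg (args A)

  Covering : Atom → Set
  Covering A = ∀ t → t ⊑ᴬ A → Compound t → SameVars (VarT t) (VarA A)

  IsUnifier : Subst → Atom → Atom → Set
  IsUnifier σ A₁ A₂ = (A₁ ·ᴬ σ) ≡ (A₂ ·ᴬ σ)

  IsMGU : Subst → Atom → Atom → Set
  IsMGU σ A₁ A₂ = IsUnifier σ A₁ A₂ ×
    (∀ θ → IsUnifier θ A₁ A₂ → ∃ λ (η : Subst) → ∀ x → θ x ≡ (σ x · η))

module Submission where

-- The heart of the theorem is that the mgu σ sends every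
-- variable of A₁ to a variable or a constant, i.e. a term of depth 0.
-- Flatness of Gσ and 𝒢σ follows at once, and the equalities of variable
-- sets survive because Var(Eσ) is the σ-image of Var(E).
--
-- To bound σ on Var(A₁), let c be a compound argument of A₁ and
-- D = depth(cσ).  Covering and simplicity force every compound argument
-- of A₁ or A₂ to be instantiated to depth exactly D and every variable of
-- A₁ strictly below D.  Cutting terms at level D (collapse terms of depth
-- < D, keep only the head of deeper ones) gives θ x = cut(σ x), which
-- unifies A₁ and A₂ and is flat on Var(A₁).  As θ factors through σ and
-- instantiation never decreases depth, σ is flat on Var(A₁) as well.

open import Defs
open import Data.Nat using (ℕ; zero; suc; _≤_; _<_; _⊔_; z≤n; s≤s; _<?_)
open import Data.Nat.Properties
open import Data.Product using (_×_; _,_; proj₁; proj₂; ∃)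
open import Data.Sum using (_⊎_; inj₁; inj₂)
open import Data.Unit using (tt)
open import Data.Empty using (⊥; ⊥-elim)
open import Data.Vec using (Vec; []; _∷_)
import Data.Vec as Vec
open import Data.Vec.Properties using (∷-injectiveˡ; ∷-injectiveʳ)
open import Data.Vec.Relation.Unary.Any using (Any; here; there)
import Data.Vec.Relation.Unary.All as VAll
open import Data.Vec.Membership.Propositional using (find; lose) renaming (_∈_ to _∈ᵛ_)
open import Data.List using (List)
open import Data.List.Relation.Unary.All using (All)
import Data.List.Relation.Unary.All as LAll
open import Data.List.Relation.Unary.All.Properties using (map⁺)
open import Data.List.Membership.Propositional.Properties using (∈-map⁺; ∈-map⁻)
open import Relation.Nullary using (yes; no)
open import Relation.Binary.PropositionalEquality

module _ {S : Signature} where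
  open Signature S

  private
    T : Set
    T = Term {S}

  sameVars-sym : ∀ {P Q : ℕ → Set} → SameVars P Q → SameVars Q P
  sameVars-sym e x = proj₂ (e x) , proj₁ (e x)

  sameVars-trans : ∀ {P Q R : ℕ → Set} → SameVars P Q → SameVars Q R → SameVars P R
  sameVars-trans e f x = (λ p → proj₁ (f x) (proj₁ (e x) p)) , (λ r → proj₂ (e x) (proj₂ (f x) r))

  Image : Subst {S} → (ℕ → Set) → ℕ → Set
  Image σ P x = ∃ λ z → P z × x ∈ᵥ σ z

  image-cong : ∀ (σ : Subst {S}) {P Q : ℕ → Set} → SameVars P Q → SameVars (Image σ P) (Image σ Q)
  image-cong σ e x = (λ { (z , pz , xz) → z , proj₁ (e z) pz , xz })
                   , (λ { (z , qz , xz) → z , proj₂ (e z) qz , xz })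

  module Variables (σ : Subst {S}) where

    mutual
      vars-·⁺ : ∀ {x} (u : T) → x ∈ᵥ (u · σ) → Image σ (VarT u) x
      vars-·⁺ (var z)    x∈ = z , here , x∈
      vars-·⁺ (fun f us) (there x∈) with vars-·ᵛ⁺ us x∈
      ... | z , z∈ , x∈σz = z , there z∈ , x∈σz

      vars-·ᵛ⁺ : ∀ {x n} (us : Vec T n) → Any (x ∈ᵥ_) (us ·ᵛ σ) → Image σ (λ z → Any (z ∈ᵥ_) us) x
      vars-·ᵛ⁺ (u ∷ us) (here x∈) with vars-·⁺ u x∈
      ... | z , z∈ , x∈σz = z , here z∈ , x∈σz
      vars-·ᵛ⁺ (u ∷ us) (there x∈) with vars-·ᵛ⁺ us x∈
      ... | z , z∈ , x∈σz = z , there z∈ , x∈σz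

    mutual
      vars-·⁻ : ∀ {x z} {u : T} → z ∈ᵥ u → x ∈ᵥ σ z → x ∈ᵥ (u · σ)
      vars-·⁻ here      x∈ = x∈
      vars-·⁻ (there z∈) x∈ = there (vars-·ᵛ⁻ z∈ x∈)

      vars-·ᵛ⁻ : ∀ {x z n} {us : Vec T n} → Any (z ∈ᵥ_) us → x ∈ᵥ σ z → Any (x ∈ᵥ_) (us ·ᵛ σ)
      vars-·ᵛ⁻ (here z∈)  x∈ = here (vars-·⁻ z∈ x∈)
      vars-·ᵛ⁻ (there z∈) x∈ = there (vars-·ᵛ⁻ z∈ x∈)

    varsA-· : (A : Atom {S}) → SameVars (VarA (A ·ᴬ σ)) (Image σ (VarA A))
    varsA-· (atom p ts) x = vars-·ᵛ⁺ ts , λ { (z , z∈ , x∈) → vars-·ᵛ⁻ z∈ x∈ }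

    varsL-· : (L : Literal {S}) → SameVars (VarL (L ·ᴸ σ)) (Image σ (VarL L))
    varsL-· (lit b A) = varsA-· A

    varsLs-· : (Ls : List (Literal {S})) → SameVars (VarLs (Ls ·ˢ σ)) (Image σ (VarLs Ls))
    varsLs-· Ls x = to , from
      where
      to : VarLs (Ls ·ˢ σ) x → Image σ (VarLs Ls) x
      to (L′ , L′∈ , x∈) with ∈-map⁻ (_·ᴸ σ) L′∈
      ... | L , L∈ , refl with proj₁ (varsL-· L x) x∈
      ... | z , z∈ , x∈σz = z , (L , L∈ , z∈) , x∈σz

      from : Image σ (VarLs Ls) x → VarLs (Ls ·ˢ σ) x
      from (z , (L , L∈ , z∈) , x∈σz) = L ·ᴸ σ , ∈-map⁺ (_·ᴸ σ) L∈ , proj₂ (varsL-· L x) (z , z∈ , x∈σz)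

    sameVars-· : ∀ {P P′ Q Q′ : ℕ → Set}
      → SameVars P′ (Image σ P) → SameVars Q′ (Image σ Q) → SameVars P Q → SameVars P′ Q′
    sameVars-· eP eQ e = sameVars-trans eP (sameVars-trans (image-cong σ e) (sameVars-sym eQ))

  const-· : ∀ (ρ : Subst {S}) (u : T) → IsConst u → u · ρ ≡ u
  const-· ρ (fun f ws) n≡0 = cong (fun f) (empty ws n≡0)
    where
    empty : ∀ {n} (ws : Vec T n) → n ≡ 0 → ws ·ᵛ ρ ≡ ws
    empty [] _ = refl

  varOrConst-or-compound : (u : T) → VarOrConst u ⊎ Compound u
  varOrConst-or-compound (var x) = inj₁ (inj₁ tt)
  varOrConst-or-compound (fun f ws) with 0 <? arity f
  ... | yes c = inj₂ c
  ... | no c  = inj₁ (inj₂ (n≤0⇒n≡0 (≮⇒≥ c)))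

  flat-·ᴸ : ∀ (σ : Subst {S}) (L : Literal {S}) → FlatL L
    → (∀ x → VarL L x → VarOrConst (σ x)) → FlatL (L ·ᴸ σ)
  flat-·ᴸ σ (lit b (atom p ts)) = flat-·ᵛ ts
    where
    flat-·ᵛ : ∀ {n} (ts : Vec T n) → VAll.All VarOrConst ts
      → (∀ x → Any (x ∈ᵥ_) ts → VarOrConst (σ x)) → VAll.All VarOrConst (ts ·ᵛ σ)
    flat-·ᵛ [] _ _ = VAll.[]
    flat-·ᵛ (var z ∷ ts)    (_ VAll.∷ fs) h = h z (here here) VAll.∷ flat-·ᵛ ts fs (λ x x∈ → h x (there x∈))
    flat-·ᵛ (fun c ws ∷ ts) (inj₂ e VAll.∷ fs) h =
      subst VarOrConst (sym (const-· σ (fun c ws) e)) (inj₂ e) VAll.∷ flat-·ᵛ ts fs (λ x x∈ → h x (there x∈))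

  mutual
    depth : T → ℕ
    depth (var _)    = 0
    depth (fun f ts) = depthᵛ ts

    depthᵛ : ∀ {n} → Vec T n → ℕ
    depthᵛ []       = 0
    depthᵛ (t ∷ ts) = suc (depth t) ⊔ depthᵛ ts

  varOrConst-depth : (u : T) → VarOrConst u → depth u ≡ 0
  varOrConst-depth (var x)    _        = refl
  varOrConst-depth (fun f ws) (inj₂ e) = empty ws e
    where
    empty : ∀ {n} (ws : Vec T n) → n ≡ 0 → depthᵛ ws ≡ 0
    empty [] _ = refl

  compound-· : ∀ (ρ : Subst {S}) (c : T) → Compound c → Compound (c · ρ)
  compound-· ρ (fun f us) cc = cc

  compound-depth : (u : T) → Compound u → 0 < depth u
  compound-depth (fun f ts) 0<n = nonempty ts 0<n
    where
    nonempty : ∀ {n} (ts : Vec T n) → 0 < n → 0 < depthᵛ ts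
    nonempty (t ∷ ts) _ = ≤-trans (s≤s z≤n) (m≤m⊔n (suc (depth t)) (depthᵛ ts))

  depth-varOrConst : (u : T) → depth u ≡ 0 → VarOrConst u
  depth-varOrConst u d with varOrConst-or-compound u
  ... | inj₁ v = v
  ... | inj₂ c = ⊥-elim (<-irrefl (sym d) (compound-depth u c))

  mutual
    depth-· : ∀ (η : Subst {S}) (u : T) → depth u ≤ depth (u · η)
    depth-· η (var x)    = z≤n
    depth-· η (fun f ts) = depthᵛ-· η ts

    depthᵛ-· : ∀ (η : Subst {S}) {n} (ts : Vec T n) → depthᵛ ts ≤ depthᵛ (ts ·ᵛ η)
    depthᵛ-· η []       = z≤n
    depthᵛ-· η (t ∷ ts) = ⊔-mono-≤ (s≤s (depth-· η t)) (depthᵛ-· η ts)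

  -- A most general unifier is at most as deep as any other unifier,
  -- variable by variable, because the other unifier factors through it.
  mgu-depth : ∀ {σ θ : Subst {S}} {A₁ A₂ : Atom {S}} → IsMGU σ A₁ A₂ → IsUnifier θ A₁ A₂
    → ∀ x → depth (σ x) ≤ depth (θ x)
  mgu-depth {σ} {θ} (_ , factor) θ-unif x with factor θ θ-unif
  ... | η , θ≡ση = subst (depth (σ x) ≤_) (cong depth (sym (θ≡ση x))) (depth-· η (σ x))

  module Depths (σ : Subst {S}) where

    mutual
      var-depth-≤ : ∀ {x} {u : T} → x ∈ᵥ u → depth (σ x) ≤ depth (u · σ)
      var-depth-≤ here       = ≤-refl
      var-depth-≤ (there x∈) = <⇒≤ (var-depth-< x∈)

      var-depth-< : ∀ {x n} {ts : Vec T n} → Any (x ∈ᵥ_) ts → depth (σ x) < depthᵛ (ts ·ᵛ σ)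
      var-depth-< {ts = t ∷ ts} (here x∈)  = ≤-trans (s≤s (var-depth-≤ x∈)) (m≤m⊔n _ (depthᵛ (ts ·ᵛ σ)))
      var-depth-< {ts = t ∷ ts} (there x∈) = ≤-trans (var-depth-< x∈) (m≤n⊔m (suc (depth (t · σ))) _)

    var-below-compound : ∀ {x} (c : T) → Compound c → x ∈ᵥ c → depth (σ x) < depth (c · σ)
    var-below-compound (fun f us) _ (there x∈) = var-depth-< x∈

    depthᵛ-≤ : ∀ {k n} (ts : Vec T n) → (∀ {t} → t ∈ᵛ ts → depth (t · σ) < k) → depthᵛ (ts ·ᵛ σ) ≤ k
    depthᵛ-≤ []       _ = z≤n
    depthᵛ-≤ (t ∷ ts) h = ⊔-lub (h (here refl)) (depthᵛ-≤ ts (λ t∈ → h (there t∈)))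

    depthᵛ-< : ∀ {k n t} (ts : Vec T n) → depthᵛ (ts ·ᵛ σ) ≤ k → t ∈ᵛ ts → depth (t · σ) < k
    depthᵛ-< (t ∷ ts) d (here refl) = m⊔n≤o⇒m≤o (suc (depth (t · σ))) (depthᵛ (ts ·ᵛ σ)) d
    depthᵛ-< (t ∷ ts) d (there t∈) = depthᵛ-< ts (m⊔n≤o⇒n≤o (suc (depth (t · σ))) (depthᵛ (ts ·ᵛ σ)) d) t∈

    leaf-depth : ∀ {k} (w : T) → VarOrConst w → (∀ y → y ∈ᵥ w → depth (σ y) < k) → 0 < k → depth (w · σ) < k
    leaf-depth (var y)    _        h _   = h y here
    leaf-depth (fun c ws) (inj₂ e) _ 0<k =
      subst (_< _) (sym (trans (cong depth (const-· σ (fun c ws) e)) (varOrConst-depth (fun c ws) (inj₂ e)))) 0<k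

    simple-dominated : (c s : T) → Compound c → SimpleArg s → (∀ y → y ∈ᵥ s → y ∈ᵥ c)
      → depth (s · σ) ≤ depth (c · σ)
    simple-dominated c (var y)    cc _       s⊆c = <⇒≤ (var-below-compound c cc (s⊆c y here))
    simple-dominated c (fun g ws) cc ws-flat s⊆c = depthᵛ-≤ ws λ w∈ →
      leaf-depth _ (VAll.lookup ws-flat w∈) (λ y y∈ → var-below-compound c cc (s⊆c y (there (lose w∈ y∈))))
        (compound-depth (c · σ) (compound-· σ c cc))

  compound-above : ∀ {t u : T} → t ⊑ u → Compound t → Compound u
  compound-above self    ct = ct
  compound-above (sub p) _  = nonempty p
    where
    nonempty : ∀ {n P} {ts : Vec T n} → Any P ts → 0 < n
    nonempty (here _)  = s≤s z≤n
    nonempty (there _) = s≤s z≤n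

  varOrConst-not-compound : (u : T) → VarOrConst u → Compound u → ⊥
  varOrConst-not-compound (fun f ws) (inj₂ e) c = <-irrefl (sym e) c

  compound-⊑-simple : ∀ {t} (a : T) → SimpleArg a → t ⊑ a → Compound t → t ≡ a
  compound-⊑-simple a          _       self       _  = refl
  compound-⊑-simple (fun f us) us-flat (sub t⊑us) ct with find t⊑us
  ... | u , u∈ , t⊑u = ⊥-elim (varOrConst-not-compound u (VAll.lookup us-flat u∈) (compound-above t⊑u ct))

  compound-argument : (A : Atom {S}) → SimpleA A → ContainsCompound A
    → ∃ λ c → c ∈ᵛ args A × Compound c
  compound-argument A simpleA (t , t⊑A , ct) with find t⊑A
  ... | a , a∈ , t⊑a = a , a∈ , subst Compound (compound-⊑-simple a (VAll.lookup simpleA a∈) t⊑a ct) ct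

  -- In a simple covering atom every compound argument c has all variables
  -- of the atom, so σ maps c at least as deep as any other argument and
  -- strictly deeper than any variable of the atom.
  module Covering-Depths (σ : Subst {S}) (B : Atom {S}) (simpleB : SimpleA B) (coveringB : Covering B) where
    open Depths σ

    vars-in-compound : ∀ {c} → c ∈ᵛ args B → Compound c → ∀ x → VarA B x → x ∈ᵥ c
    vars-in-compound c∈ cc x = proj₂ (coveringB _ (lose c∈ self) cc x)

    argument-dominated : ∀ {c s} → c ∈ᵛ args B → Compound c → s ∈ᵛ args B → depth (s · σ) ≤ depth (c · σ)
    argument-dominated c∈ cc s∈ = simple-dominated _ _ cc (VAll.lookup simpleB s∈)
      (λ y y∈s → vars-in-compound c∈ cc y (lose s∈ y∈s))

    variable-below : ∀ {c} → c ∈ᵛ args B → Compound c → ∀ x → VarA B x → depth (σ x) < depth (c · σ)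
    variable-below c∈ cc x x∈ = var-below-compound _ cc (vars-in-compound c∈ cc x x∈)

  atom-args-injective : ∀ {p} {xs ys : Vec T (parity p)} → atom p xs ≡ atom p ys → xs ≡ ys
  atom-args-injective refl = refl

  partner : ∀ {σ : Subst {S}} {n a} {as bs : Vec T n} → as ·ᵛ σ ≡ bs ·ᵛ σ → a ∈ᵛ as
    → ∃ λ b → b ∈ᵛ bs × a · σ ≡ b · σ
  partner {as = a ∷ as} {b ∷ bs} e (here refl) = b , here refl , ∷-injectiveˡ e
  partner {as = a ∷ as} {b ∷ bs} e (there a∈) with partner (∷-injectiveʳ e) a∈
  ... | b′ , b′∈ , e′ = b′ , there b′∈ , e′

  ·ᵛ-transfer : ∀ {σ θ : Subst {S}} {n} {as bs : Vec T n} → as ·ᵛ σ ≡ bs ·ᵛ σ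
    → (∀ {a b} → a ∈ᵛ as → b ∈ᵛ bs → a · σ ≡ b · σ → a · θ ≡ b · θ) → as ·ᵛ θ ≡ bs ·ᵛ θ
  ·ᵛ-transfer {as = []}     {[]}     _ _ = refl
  ·ᵛ-transfer {as = a ∷ as} {b ∷ bs} e h = cong₂ _∷_ (h (here refl) (here refl) (∷-injectiveˡ e))
    (·ᵛ-transfer (∷-injectiveʳ e) (λ a∈ b∈ → h (there a∈) (there b∈)))

  module Cut (D : ℕ) where

    -- Terms of depth 0 are kept, deeper ones are replaced by some term of
    -- depth 0 (the choice of var 0 is immaterial).
    collapse : T → T
    collapse u with depth u
    ... | zero  = u
    ... | suc _ = var 0

    collapse-id : (u : T) → depth u ≡ 0 → collapse u ≡ u
    collapse-id u d rewrite d = refl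

    collapse-flat : (u : T) → depth (collapse u) ≡ 0
    collapse-flat u with depth u in d
    ... | zero  = d
    ... | suc _ = refl

    shallow : T → T
    shallow (var x)    = var x
    shallow (fun f ts) = fun f (Vec.map collapse ts)

    cut : T → T
    cut u with depth u <? D
    ... | yes _ = collapse u
    ... | no _  = shallow u

    cut-< : (u : T) → depth u < D → cut u ≡ collapse u
    cut-< u d with depth u <? D
    ... | yes _ = refl
    ... | no d≮ = ⊥-elim (d≮ d)

    cut-flat : 0 < D → (u : T) → depth u ≡ 0 → cut u ≡ u
    cut-flat 0<D u d = trans (cut-< u (subst (_< D) (sym d) 0<D)) (collapse-id u d)

    cut-≥ : (u : T) → D ≤ depth u → cut u ≡ shallow u
    cut-≥ u d with depth u <? D
    ... | yes d< = ⊥-elim (<⇒≱ d< d)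
    ... | no _   = refl

  module Cut-Instance (σ : Subst {S}) (D : ℕ) (0<D : 0 < D) where
    open Cut D
    open Depths σ

    θ : Subst {S}
    θ z = cut (σ z)

    leaf-commutes : (w : T) → VarOrConst w → depth (w · σ) < D → w · θ ≡ collapse (w · σ)
    leaf-commutes (var z)    _        d = cut-< (σ z) d
    leaf-commutes (fun c ws) (inj₂ e) _ = begin
      w · θ            ≡⟨ const-· θ w e ⟩
      w                ≡⟨ sym (collapse-id w (varOrConst-depth w (inj₂ e))) ⟩
      collapse w       ≡⟨ cong collapse (sym (const-· σ w e)) ⟩
      collapse (w · σ) ∎
      where
      open ≡-Reasoning
      w = fun c ws

    ·ᵛ-collapse : ∀ {n} (ws : Vec T n) → (∀ {w} → w ∈ᵛ ws → w · θ ≡ collapse (w · σ))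
      → ws ·ᵛ θ ≡ Vec.map collapse (ws ·ᵛ σ)
    ·ᵛ-collapse []       _ = refl
    ·ᵛ-collapse (w ∷ ws) h = cong₂ _∷_ (h (here refl)) (·ᵛ-collapse ws (λ w∈ → h (there w∈)))

    cut-commutes : (a : T) → SimpleArg a → (Compound a → depth (a · σ) ≡ D) → a · θ ≡ cut (a · σ)
    cut-commutes (var z)    _       _        = refl
    cut-commutes (fun f ws) ws-flat balanced with varOrConst-or-compound (fun f ws)
    ... | inj₁ (inj₂ e) = begin
      a · θ   ≡⟨ const-· θ a e ⟩
      a       ≡⟨ sym (cut-flat 0<D a (varOrConst-depth a (inj₂ e))) ⟩
      cut a   ≡⟨ cong cut (sym (const-· σ a e)) ⟩
      cut (a · σ) ∎
      where
      open ≡-Reasoning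
      a = fun f ws
    ... | inj₂ c = begin
      fun f (ws ·ᵛ θ)                          ≡⟨ cong (fun f) (·ᵛ-collapse ws child) ⟩
      fun f (Vec.map collapse (ws ·ᵛ σ))       ≡⟨ sym (cut-≥ (fun f ws · σ) (≤-reflexive (sym (balanced c)))) ⟩
      cut (fun f ws · σ)                       ∎
      where
      open ≡-Reasoning
      child : ∀ {w} → w ∈ᵛ ws → w · θ ≡ collapse (w · σ)
      child w∈ = leaf-commutes _ (VAll.lookup ws-flat w∈) (depthᵛ-< ws (≤-reflexive (balanced c)) w∈)

  module _ (σ : Subst {S}) {p : Pred} {as bs : Vec T (parity p)}
           (simple₁ : SimpleA (atom p as)) (simple₂ : SimpleA (atom p bs))
           (covering₁ : Covering (atom p as)) (covering₂ : Covering (atom p bs))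
           (mgu : IsMGU σ (atom p as) (atom p bs)) (compound₁ : ContainsCompound (atom p as)) where

    private
      σ-unifies : as ·ᵛ σ ≡ bs ·ᵛ σ
      σ-unifies = atom-args-injective (proj₁ mgu)

      c∈c : ∃ λ c → c ∈ᵛ as × Compound c
      c∈c = compound-argument (atom p as) simple₁ compound₁

      c : T
      c = proj₁ c∈c

      c∈ : c ∈ᵛ as
      c∈ = proj₁ (proj₂ c∈c)

      cc : Compound c
      cc = proj₂ (proj₂ c∈c)

      D : ℕ
      D = depth (c · σ)

      D-positive : 0 < D
      D-positive = compound-depth (c · σ) (compound-· σ c cc)

      open Cut D
      open Cut-Instance σ D D-positive
      module A₁ = Covering-Depths σ (atom p as) simple₁ covering₁
      module A₂ = Covering-Depths σ (atom p bs) simple₂ covering₂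

      balanced₁ : ∀ {a} → a ∈ᵛ as → Compound a → depth (a · σ) ≡ D
      balanced₁ a∈ ca = ≤-antisym (A₁.argument-dominated c∈ cc a∈) (A₁.argument-dominated a∈ ca c∈)

      -- So are those of A₂: they dominate the partner of c and are
      -- identified by σ with an argument of A₁, which is dominated by c.
      balanced₂ : ∀ {a b} → a ∈ᵛ as → b ∈ᵛ bs → a · σ ≡ b · σ → Compound b → depth (b · σ) ≡ D
      balanced₂ {b = b} a∈ b∈ e cb with partner σ-unifies c∈
      ... | s , s∈ , cσ≡sσ = ≤-antisym
        (subst (λ u → depth u ≤ D) e (A₁.argument-dominated c∈ cc a∈))
        (subst (λ u → depth u ≤ depth (b · σ)) (sym cσ≡sσ)
          (A₂.argument-dominated b∈ cb s∈))

      -- θ identifies each pair of arguments that σ identifies, as both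
      -- sides are obtained by cutting their common σ-instance.
      θ-unifies : IsUnifier θ (atom p as) (atom p bs)
      θ-unifies = cong (atom p) (·ᵛ-transfer σ-unifies λ {a} {b} a∈ b∈ e → begin
        a · θ        ≡⟨ cut-commutes a (VAll.lookup simple₁ a∈) (balanced₁ a∈) ⟩
        cut (a · σ)  ≡⟨ cong cut e ⟩
        cut (b · σ)  ≡⟨ sym (cut-commutes b (VAll.lookup simple₂ b∈) (balanced₂ a∈ b∈ e)) ⟩
        b · θ        ∎)
        where open ≡-Reasoning

      -- Variables of A₁ lie strictly below level D, so θ collapses them.
      θ-flat : ∀ x → VarA (atom p as) x → depth (θ x) ≡ 0
      θ-flat x x∈ = trans (cong depth (cut-< (σ x) (A₁.variable-below c∈ cc x x∈))) (collapse-flat (σ x))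

    -- σ is no deeper than θ on each variable, and θ is flat on Var(A₁).
    mgu-flattens : ∀ x → VarA (atom p as) x → VarOrConst (σ x)
    mgu-flattens x x∈ = depth-varOrConst (σ x)
      (n≤0⇒n≡0 (subst (depth (σ x) ≤_) (θ-flat x x∈) (mgu-depth mgu θ-unifies x)))

  -- The same for arbitrary atoms: unifiable atoms share their predicate.
  mgu-flattens-atoms : ∀ (σ : Subst {S}) (A₁ A₂ : Atom {S}) → SimpleA A₁ → SimpleA A₂ → Covering A₁ → Covering A₂
    → IsMGU σ A₁ A₂ → ContainsCompound A₁ → ∀ x → VarA A₁ x → VarOrConst (σ x)
  mgu-flattens-atoms σ (atom p as) (atom q bs) simple₁ simple₂ covering₁ covering₂ mgu compound₁
    with cong pred (proj₁ mgu)
  ... | refl = mgu-flattens σ simple₁ simple₂ covering₁ covering₂ mgu compound₁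

mainTheorem7 : (S : Signature) (A₁ A₂ : Atom {S}) (σ : Subst {S}) (G : Literal {S}) (𝒢 : List (Literal {S}))
    → SimpleA A₁ → SimpleA A₂ → Covering A₁ → Covering A₂
    → IsMGU σ A₁ A₂
    → FlatL G → All FlatL 𝒢
    → SameVars (VarA A₁) (VarL G) → SameVars (VarA A₁) (VarLs 𝒢)
    → ContainsCompound A₁
    → FlatL (G ·ᴸ σ) × All FlatL (𝒢 ·ˢ σ)
      × SameVars (VarA (A₁ ·ᴬ σ)) (VarL (G ·ᴸ σ)) × SameVars (VarA (A₁ ·ᴬ σ)) (VarLs (𝒢 ·ˢ σ))
mainTheorem7 S A₁ A₂ σ G 𝒢 simple₁ simple₂ covering₁ covering₂ mgu flatG flat𝒢 varsG vars𝒢 compound₁ =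
    flat-·ᴸ σ G flatG (λ x x∈G → leaf x (proj₂ (varsG x) x∈G))
  , map⁺ (LAll.tabulate λ {L} L∈ →
      flat-·ᴸ σ L (LAll.lookup flat𝒢 L∈) (λ x x∈L → leaf x (proj₂ (vars𝒢 x) (L , L∈ , x∈L))))
  , sameVars-· (varsA-· A₁) (varsL-· G) varsG
  , sameVars-· (varsA-· A₁) (varsLs-· 𝒢) vars𝒢
  where
  open Variables σ

  leaf : ∀ x → VarA A₁ x → VarOrConst (σ x)
  leaf = mgu-flattens-atoms σ A₁ A₂ simple₁ simple₂ covering₁ covering₂ mgu compound₁
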